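{- Let $R$ be a finite Frobenius ring and $w$ a homogeneous weight on $R$ with average value $\gamma>0$, extended additively to $R^n$. Let $C\leq {}_RR^n$ be a nonzero linear code of length $n$ and minimum homogeneous weight $d$ with $\gamma n\leq d$. Let $Q:=\max\{|Rc| : c\in C\}$ and $P:=\max\{|Rc| : c\in C,\ \ell(c)<n\}$. If $c\in C$ satisfies $\ell(c)<n$, then $|Rc'|\leq Q$ for every $c'\in\mathrm{Res}(C,c)$. Moreover, if such $c'$ satisfies $\ell(c')<n-\ell(c)$, then $|Rc'|\leq P$.
   Context: A finite ring $R$ (with identity) is Frobenius if the character group of $(R,+)$ is isomorphic to $R$ as a left $R$-module (equivalently, $R$ has a character whose kernel contains no nonzero left or right ideal). A function $w:R\to\mathbb{R}$ is a homogeneous weight with average value $\gamma$ if $w(0)=0$, $w(x)=w(y)$ whenever $Rx=Ry$, and $\sum_{y\in Rx} w(y)=\gamma|Rx|$ for all nonzero $x\in R$; on $R^n$, $w(c)=\sum_i w(c_i)$. Minimum homogeneous weight of a code is the minimum of $w$ over its nonzero words. For $c\in R^n$, $\mathrm{supp}(c)=\{i:c_i\neq0\}$ and $\ell(c)=|\mathrm{supp}(c)|$. The residual code is $\mathrm{Res}(C,c)=\{(x_i)_{i\notin\mathrm{supp}(c)} : x\in C\}\leq {}_RR^{\,n-\ell(c)}$.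
   Formalization: The homogeneous weight w and its average value γ take values in ℚ rather than ℝ, so the minimum homogeneous weight d is rational as well. -}

module Defs where

open import Data.Nat as ℕ using (ℕ; zero; suc)
open import Data.Nat.DivMod using (_%_)
open import Data.Fin as Fin using (Fin)
open import Data.Fin.Properties using () renaming (_≟_ to _≟F_)
open import Data.List as List using (List; length; filter; deduplicate; allFin)
open import Data.Vec as Vec using (Vec; toList; zip; zipWith; replicate)
open import Data.Vec.Properties using (≡-dec)
open import Data.Product using (Σ; ∃; _×_; _,_; proj₁; proj₂)
open import Data.Integer using (+_)
open import Data.Rational as ℚ using (ℚ)
open import Relation.Binary.PropositionalEquality using (_≡_; _≢_)
open import Relation.Nullary using (¬_; ¬?)
open import Algebra.Core using (Op₁; Op₂)
open import Algebra.Structures using (IsRing)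
open import Function.Bundles using (_⇔_)

ℕtoℚ : ℕ → ℚ
ℕtoℚ n = (+ n) ℚ./ 1

sumℚ : List ℚ → ℚ
sumℚ = List.foldr ℚ._+_ ℚ.0ℚ

-- A finite ring: WLOG its underlying set is Fin m (every finite ring with m
-- elements is isomorphic to such a ring); equality is propositional.
record FinRing (m : ℕ) : Set where
  infixl 7 _*_
  infixl 6 _+_
  field
    _+_ _*_ : Op₂ (Fin m)
    -_      : Op₁ (Fin m)
    0# 1#   : Fin m
    isRing  : IsRing _≡_ _+_ _*_ -_ 0# 1#

module _ {k : ℕ} (R : FinRing (suc k)) where
  open FinRing R

  private
    m : ℕ
    m = suc k
    Car : Set
    Car = Fin m

  -- additive characters of (R,+): homomorphisms into ℤ/mℤ (the character
  -- group of a group of order m takes values in the m-th roots of unity ≅ ℤ/mℤ)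
  IsCharacter : (Car → ℕ) → Set
  IsCharacter χ = ∀ x y → χ (x + y) % m ≡ (χ x ℕ.+ χ y) % m

  InKer : (Car → ℕ) → Car → Set
  InKer χ x = χ x % m ≡ 0

  IsLeftIdeal : (Car → Set) → Set
  IsLeftIdeal I = I 0# × (∀ x y → I x → I y → I (x + y)) × (∀ x → I x → I (- x))
                × (∀ r x → I x → I (r * x))

  IsRightIdeal : (Car → Set) → Set
  IsRightIdeal I = I 0# × (∀ x y → I x → I y → I (x + y)) × (∀ x → I x → I (- x))
                 × (∀ r x → I x → I (x * r))

  Frobenius : Set₁
  Frobenius = Σ (Car → ℕ) λ χ → IsCharacter χ
    × (∀ (I : Car → Set) → IsLeftIdeal I → (∀ x → I x → InKer χ x) → ∀ x → I x → x ≡ 0#)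
    × (∀ (I : Car → Set) → IsRightIdeal I → (∀ x → I x → InKer χ x) → ∀ x → I x → x ≡ 0#)

  Rx₁ : Car → List Car
  Rx₁ x = deduplicate _≟F_ (List.map (λ r → r * x) (allFin m))

  _∈R_ : Car → Car → Set
  z ∈R x = ∃ λ r → z ≡ r * x

  IsHomogeneousWeight : (Car → ℚ) → ℚ → Set
  IsHomogeneousWeight w γ =
      (w 0# ≡ ℚ.0ℚ)
    × (∀ x y → (∀ z → (z ∈R x) ⇔ (z ∈R y)) → w x ≡ w y)
    × (∀ x → x ≢ 0# → sumℚ (List.map w (Rx₁ x)) ≡ γ ℚ.* ℕtoℚ (length (Rx₁ x)))

  Word : ℕ → Set
  Word n = Vec Car n

  0w : ∀ {n} → Word n
  0w = replicate _ 0#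

  _+w_ : ∀ {n} → Word n → Word n → Word n
  _+w_ = zipWith _+_

  _·w_ : ∀ {n} → Car → Word n → Word n
  r ·w x = Vec.map (r *_) x

  cardR : ∀ {n} → Word n → ℕ
  cardR {n} c = length (deduplicate (≡-dec _≟F_) (List.map (λ r → r ·w c) (allFin m)))

  ℓ : ∀ {n} → Word n → ℕ
  ℓ c = Vec.count (λ a → ¬? (a ≟F 0#)) c

  wt : (Car → ℚ) → ∀ {n} → Word n → ℚ
  wt w c = sumℚ (List.map w (toList c))

  IsLinearCode : ∀ {n} → (Word n → Set) → Set
  IsLinearCode C = C 0w × (∀ x y → C x → C y → C (x +w y)) × (∀ r x → C x → C (r ·w x))

  restrict : ∀ {n} → Word n → Word n → List Car
  restrict c x = List.map proj₂ (filter (λ p → proj₁ p ≟F 0#) (toList (zip c x)))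

  InRes : ∀ {n} → (Word n → Set) → (c : Word n) → Word (n ℕ.∸ ℓ c) → Set
  InRes C c c' = ∃ λ x → C x × toList c' ≡ restrict c x

IsMaxℕ : ℕ → (ℕ → Set) → Set
IsMaxℕ q S = S q × (∀ s → S s → s ℕ.≤ q)

IsMinℚ : ℚ → (ℚ → Set) → Set
IsMinℚ q S = S q × (∀ s → S s → q ℚ.≤ s)

-- Write c' as the restriction of a codeword x to the positions outside supp(c).
-- Restriction is R-linear, so it maps Rx onto Rc' and |Rc'| ≤ |Rx| ≤ Q. A zero
-- entry of c' is a zero entry of x, so ℓ(c') < n − ℓ(c) forces ℓ(x) < n, and
-- then |Rx| ≤ P.
module Submission where

open import Defs
open import Data.Nat using (ℕ; suc; _∸_) renaming (_<_ to _<ℕ_; _≤_ to _≤ℕ_)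
open import Data.Fin using (Fin)
open import Data.Product using (∃; _×_)
open import Data.Rational using (ℚ; _≤_; _<_; _*_; 0ℚ)
open import Relation.Binary.PropositionalEquality using (_≡_; _≢_)

open import Data.Nat using (z≤n; s≤s)
open import Data.Nat.Properties using (≤-trans; ≤-pred; module ≤-Reasoning)
open import Data.Product using (_,_)
open import Data.List as List using (List; _∷_; [_]; _++_; length; deduplicate; allFin)
open import Data.List.Properties using (length-map)
open import Data.List.Membership.Propositional using (_∈_)
open import Data.List.Membership.Propositional.Properties
  using (∈-∃++; ∈-map⁺; ∈-map⁻; deduplicate-∈⇔)
open import Data.List.Relation.Binary.Subset.Propositional using (_⊆_)
open import Data.List.Relation.Binary.Permutation.Propositional.Properties
  using (shift; ↭-length; ∈-resp-↭)
open import Data.List.Relation.Unary.Any using (here; there)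
import Data.List.Relation.Unary.All as All
open import Data.List.Relation.Unary.AllPairs using ([]; _∷_)
open import Data.List.Relation.Unary.Unique.Propositional using (Unique)
import Data.List.Relation.Unary.Unique.Propositional.Properties as Unique
open import Data.List.Relation.Unary.Unique.DecPropositional.Properties using (deduplicate-!)
open import Data.Vec as Vec using (toList)
open import Data.Vec.Properties using (≡-dec; toList-map; toList-injective; cast-is-id; count≤n)
open import Data.Fin.Properties using () renaming (_≟_ to _≟F_)
open import Function.Bundles using (Equivalence)
open import Function.Definitions using (Injective)
open import Relation.Binary.Definitions using (DecidableEquality)
open import Relation.Binary.PropositionalEquality using (refl; sym; trans; cong; subst; module ≡-Reasoning)
open import Relation.Nullary using (yes; no; ¬?; contradiction)

Unique-⊆⇒length≤ : ∀ {A : Set} {ys xs : List A} → Unique ys → ys ⊆ xs → length ys ≤ℕ length xs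
Unique-⊆⇒length≤ [] _ = z≤n
Unique-⊆⇒length≤ {ys = y ∷ ys} (y∉ys ∷ ys-unique) ys⊆xs
  with as , bs , refl ← ∈-∃++ (ys⊆xs (here refl)) = begin
    suc (length ys)         ≤⟨ s≤s (Unique-⊆⇒length≤ ys-unique ys⊆as++bs) ⟩
    suc (length (as ++ bs)) ≡⟨ sym (↭-length (shift y as bs)) ⟩
    length (as ++ [ y ] ++ bs) ∎
  where
  open ≤-Reasoning
  ys⊆as++bs : ys ⊆ as ++ bs
  ys⊆as++bs z∈ys with ∈-resp-↭ (shift y as bs) (ys⊆xs (there z∈ys))
  ... | here z≡y = contradiction (sym z≡y) (All.lookup y∉ys z∈ys)
  ... | there z∈as++bs = z∈as++bs

toList-injective-≡ : ∀ {A : Set} {n} → Injective _≡_ _≡_ (toList {A = A} {n = n})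
toList-injective-≡ {x = u} {y = v} eq = trans (sym (cast-is-id refl u)) (toList-injective refl u v eq)

length-deduplicate-map-≤ : ∀ {A B D X : Set} (_≟A_ : DecidableEquality A) (_≟B_ : DecidableEquality B)
  {e : A → D} → Injective _≡_ _≡_ e → (f : X → A) (g : X → B) (h : B → D) →
  (∀ x → e (f x) ≡ h (g x)) → ∀ xs →
  length (deduplicate _≟A_ (List.map f xs)) ≤ℕ length (deduplicate _≟B_ (List.map g xs))
length-deduplicate-map-≤ {A} {B} _≟A_ _≟B_ {e} e-injective f g h e∘f≗h∘g xs = begin
  length imf                 ≡⟨ sym (length-map e imf) ⟩
  length (List.map e imf)    ≤⟨ Unique-⊆⇒length≤ (Unique.map⁺ e-injective (deduplicate-! _≟A_ (List.map f xs))) e[imf]⊆h[img] ⟩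
  length (List.map h img)    ≡⟨ length-map h img ⟩
  length img                 ∎
  where
  open ≤-Reasoning
  imf : List A
  imf = deduplicate _≟A_ (List.map f xs)
  img : List B
  img = deduplicate _≟B_ (List.map g xs)
  e[imf]⊆h[img] : List.map e imf ⊆ List.map h img
  e[imf]⊆h[img] z∈
    with a , a∈imf , refl ← ∈-map⁻ e z∈
    with x , x∈xs , refl ← ∈-map⁻ f (Equivalence.from (deduplicate-∈⇔ _≟A_) a∈imf)
    rewrite e∘f≗h∘g x
    = ∈-map⁺ h (Equivalence.to (deduplicate-∈⇔ _≟B_) (∈-map⁺ g x∈xs))

module _ {k : ℕ} (R : FinRing (suc k)) where
  open FinRing R using (0#) renaming (_*_ to _·_)

  restrict-·w : ∀ {n} r (c x : Word R n) → restrict R c (_·w_ R r x) ≡ List.map (r ·_) (restrict R c x)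
  restrict-·w r Vec.[] Vec.[] = refl
  restrict-·w r (a Vec.∷ c) (b Vec.∷ x) with a ≟F 0#
  ... | yes _ = cong (r · b ∷_) (restrict-·w r c x)
  ... | no _ = restrict-·w r c x

  restrict-⊆ : ∀ {n} (c x : Word R n) → restrict R c x ⊆ toList x
  restrict-⊆ Vec.[] Vec.[] ()
  restrict-⊆ (a Vec.∷ c) (b Vec.∷ x) z∈ with a ≟F 0# | z∈
  ... | yes _ | here z≡b = here z≡b
  ... | yes _ | there z∈′ = there (restrict-⊆ c x z∈′)
  ... | no _ | z∈′ = there (restrict-⊆ c x z∈′)

  0∈⇒ℓ< : ∀ {n} (v : Word R n) → 0# ∈ toList v → ℓ R v <ℕ n
  0∈⇒ℓ< (a Vec.∷ v) 0∈ with a ≟F 0# | 0∈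
  ... | yes _ | _ = s≤s (count≤n (λ b → ¬? (b ≟F 0#)) v)
  ... | no a≢0 | here 0≡a = contradiction (sym 0≡a) a≢0
  ... | no _ | there 0∈v = s≤s (0∈⇒ℓ< v 0∈v)

  ℓ<⇒0∈ : ∀ {n} (v : Word R n) → ℓ R v <ℕ n → 0# ∈ toList v
  ℓ<⇒0∈ (a Vec.∷ v) ℓ< with a ≟F 0#
  ... | yes a≡0 = here (sym a≡0)
  ... | no _ = there (ℓ<⇒0∈ v (≤-pred ℓ<))

  module _ {n} (c x : Word R n) (c' : Word R (n ∸ ℓ R c)) (c'≡x| : toList c' ≡ restrict R c x) where

    cardR-residual≤ : cardR R c' ≤ℕ cardR R x
    cardR-residual≤ =
      length-deduplicate-map-≤ (≡-dec _≟F_) (≡-dec _≟F_) toList-injective-≡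
        (λ r → _·w_ R r c') (λ r → _·w_ R r x) (restrict R c) restrict-r·x (allFin (suc k))
      where
      restrict-r·x : ∀ r → toList (_·w_ R r c') ≡ restrict R c (_·w_ R r x)
      restrict-r·x r = begin
        toList (Vec.map (r ·_) c')       ≡⟨ toList-map (r ·_) c' ⟩
        List.map (r ·_) (toList c')      ≡⟨ cong (List.map (r ·_)) c'≡x| ⟩
        List.map (r ·_) (restrict R c x) ≡⟨ sym (restrict-·w r c x) ⟩
        restrict R c (_·w_ R r x)        ∎
        where open ≡-Reasoning

    ℓ-residual<⇒ℓ< : ℓ R c' <ℕ n ∸ ℓ R c → ℓ R x <ℕ n
    ℓ-residual<⇒ℓ< ℓc'< = 0∈⇒ℓ< x (restrict-⊆ c x (subst (0# ∈_) c'≡x| (ℓ<⇒0∈ c' ℓc'<)))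

lemma5 : ∀ {k : ℕ} (R : FinRing (suc k)) → Frobenius R →
    (w : Fin (suc k) → ℚ) (γ : ℚ) → IsHomogeneousWeight R w γ → 0ℚ < γ →
    ∀ (n : ℕ) (C : Word R n → Set) → IsLinearCode R C →
    (∃ λ x → C x × x ≢ 0w R) →
    ∀ (d : ℚ) → IsMinℚ d (λ q → ∃ λ x → C x × x ≢ 0w R × q ≡ wt R w x) →
    γ * ℕtoℚ n ≤ d →
    ∀ (Q : ℕ) → IsMaxℕ Q (λ s → ∃ λ x → C x × s ≡ cardR R x) →
    ∀ (P : ℕ) → IsMaxℕ P (λ s → ∃ λ x → C x × ℓ R x <ℕ n × s ≡ cardR R x) →
    ∀ (c : Word R n) → C c → ℓ R c <ℕ n →
    ∀ (c' : Word R (n ∸ ℓ R c)) → InRes R C c c' →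
    (cardR R c' ≤ℕ Q) × (ℓ R c' <ℕ n ∸ ℓ R c → cardR R c' ≤ℕ P)
lemma5 R _ _ _ _ _ n C _ _ _ _ _ Q (_ , Q-max) P (_ , P-max) c _ _ c' (x , x∈C , c'≡x|) =
  ≤-trans |Rc'|≤|Rx| (Q-max _ (x , x∈C , refl)) ,
  λ ℓc'< → ≤-trans |Rc'|≤|Rx| (P-max _ (x , x∈C , ℓ-residual<⇒ℓ< R c x c' c'≡x| ℓc'< , refl))
  where
  |Rc'|≤|Rx| : cardR R c' ≤ℕ cardR R x
  |Rc'|≤|Rx| = cardR-residual≤ R c x c' c'≡x|
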